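{- Let $K$ be a field of characteristic $r>0$ and let $n\ge r$. In $K[x_1,\ldots,x_n]$ let $e_k$ ($1\le k\le n$) be the elementary symmetric polynomials and $p_k=\sum_{i=1}^n x_i^k$. For a partition $\lambda=(k_1,\ldots,k_l)$ with parts at most $n$, write $e_\lambda=e_{k_1}\cdots e_{k_l}$. Let $E$ be the $K$-subalgebra of $K[e_1,\ldots,e_n]$ generated by all $e_\lambda$ such that at least one part of $\lambda$ is coprime to $r$. Then $K[p_1,p_2,\ldots]\subseteq E$. -}

module Defs where

open import Level using (Level; _⊔_)
open import Algebra.Bundles using (CommutativeRing)
open import Data.Nat as ℕ using (ℕ; zero; suc; _≤_; _<_)
open import Data.Nat.Coprimality using (Coprime)
open import Data.Bool using (Bool; true; false)
open import Data.Fin using (Fin)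
open import Data.Vec as Vec using (Vec; []; _∷_)
import Data.Vec.Properties as VecP
open import Data.List as List using (List; []; _∷_; _++_; concatMap)
open import Data.List.Relation.Unary.All using (All)
open import Data.List.Relation.Unary.Any using (Any)
open import Data.Product using (_×_; _,_; Σ; ∃)
open import Relation.Nullary using (¬_; yes; no)
open import Relation.Binary.PropositionalEquality using (_≡_)

record IsField {c ℓ : Level} (R : CommutativeRing c ℓ) : Set (c ⊔ ℓ) where
  open CommutativeRing R
  field
    1≉0     : ¬ (1# ≈ 0#)
    inverse : ∀ x → ¬ (x ≈ 0#) → Σ Carrier λ y → (x * y) ≈ 1#

module _ {c ℓ : Level} (R : CommutativeRing c ℓ) where
  open CommutativeRing R

  natCast : ℕ → Carrier
  natCast zero    = 0#
  natCast (suc m) = 1# + natCast m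

  record HasCharacteristic (r : ℕ) : Set ℓ where
    field
      r-pos   : 0 < r
      r-kills : natCast r ≈ 0#
      r-least : ∀ m → 0 < m → m < r → ¬ (natCast m ≈ 0#)

-- A polynomial is a finite list of terms (coefficient, exponent vector);
-- two polynomials are equal iff every monomial has equal total coefficient.

module Poly {c ℓ : Level} (R : CommutativeRing c ℓ) (n : ℕ) where
  open CommutativeRing R

  Monomial : Set
  Monomial = Vec ℕ n

  Term : Set c
  Term = Carrier × Monomial

  Pol : Set c
  Pol = List Term

  coeff : Pol → Monomial → Carrier
  coeff []              m = 0#
  coeff ((a , u) ∷ p) m with VecP.≡-dec ℕ._≟_ u m
  ... | yes _ = a + coeff p m
  ... | no  _ = coeff p m

  _≋_ : Pol → Pol → Set ℓ
  p ≋ q = ∀ m → coeff p m ≈ coeff q m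

  const : Carrier → Pol
  const a = (a , Vec.replicate n 0) ∷ []

  zeroP oneP : Pol
  zeroP = []
  oneP  = const 1#

  _⊕_ : Pol → Pol → Pol
  p ⊕ q = p ++ q

  _⊗_ : Pol → Pol → Pol
  p ⊗ q = concatMap (λ { (a , u) → List.map (λ { (b , v) → (a * b , Vec.zipWith ℕ._+_ u v) }) q }) p

  _·_ : Carrier → Pol → Pol
  a · p = List.map (λ { (b , v) → (a * b , v) }) p

  productP : List Pol → Pol
  productP = List.foldr _⊗_ oneP

  -- all subsets of {1,…,n}, as characteristic vectors
  subsets : (k : ℕ) → List (Vec Bool k)
  subsets zero    = [] ∷ []
  subsets (suc k) = List.map (true ∷_) (subsets k) ++ List.map (false ∷_) (subsets k)

  size : ∀ {k} → Vec Bool k → ℕ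
  size []           = 0
  size (true  ∷ s)  = suc (size s)
  size (false ∷ s)  = size s

  indicator : ∀ {k} → Vec Bool k → Vec ℕ k
  indicator = Vec.map (λ { true → 1 ; false → 0 })

  e : ℕ → Pol
  e k = List.map (λ s → (1# , indicator s))
                 (List.filter (λ s → size s ℕ.≟ k) (subsets n))

  p : ℕ → Pol
  p k = List.map (λ i → (1# , Vec.updateAt (Vec.replicate n 0) i (λ _ → k)))
                 (List.allFin n)

  eλ : List ℕ → Pol
  eλ λs = productP (List.map e λs)

  data InSubalg {i} {I : Set i} (g : I → Pol) : Pol → Set (c ⊔ ℓ ⊔ i) where
    gen   : ∀ j → InSubalg g (g j)
    scalar : ∀ a → InSubalg g (const a)
    add   : ∀ {f h} → InSubalg g f → InSubalg g h → InSubalg g (f ⊕ h)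
    mul   : ∀ {f h} → InSubalg g f → InSubalg g h → InSubalg g (f ⊗ h)
    smul  : ∀ a {f} → InSubalg g f → InSubalg g (a · f)
    resp  : ∀ {f h} → f ≋ h → InSubalg g f → InSubalg g h

  record GoodPartition (r : ℕ) : Set where
    constructor goodPartition
    field
      parts    : List ℕ
      inRange  : All (λ k → 1 ≤ k × k ≤ n) parts
      hasCoprime : Any (λ k → Coprime k r) parts

  InE : (r : ℕ) → Pol → Set (c ⊔ ℓ)
  InE r = InSubalg (λ (λp : GoodPartition r) → eλ (GoodPartition.parts λp))

  PosNat : Set
  PosNat = Σ ℕ λ k → 1 ≤ k

  InPowerSums : Pol → Set (c ⊔ ℓ)
  InPowerSums = InSubalg (λ (k : PosNat) → p (Data.Product.proj₁ k))

-- Newton's identities, telescoped. Write M(i,j) = Σ_{|S|=i} Σ_{t∈S} x_S x_t^j. Splitting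
-- e_i p_{j+1} according to whether t ∈ S gives e_i p_{j+1} = M(i,j+1) + M(i+1,j), while
-- M(1,k) = p_{k+1} and M(k,0) = k e_k; hence p_k = e_1 p_{k-1} - e_2 p_{k-2} + ⋯ ± k e_k.
-- As K is a field its characteristic r is prime, so k e_k = 0 unless k is coprime to r,
-- and then e_k is itself a generator e_λ of E. The K-span of the e_λ is closed under
-- multiplication by every e_i, so by induction on k it contains every p_k; hence E
-- contains the algebra K[p_1, p_2, …].

module Submission where

open import Defs
open import Level using (Level; _⊔_)
open import Algebra.Bundles using (CommutativeRing)
open import Data.Nat as ℕ using (ℕ; zero; suc; _≤_; _<_; z≤n; s≤s; NonZero)
import Data.Nat.Properties as NP
open import Data.Nat.Divisibility using (_∣_; divides; ∣⇒≤)
open import Data.Nat.Coprimality using (Coprime; gcd≡1⇒coprime; coprime?)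
open import Data.Nat.GCD using (gcd[m,n]∣m; gcd[m,n]∣n)
open import Data.Nat.Primality using (Irreducible)
open import Data.Nat.Induction using (<-rec)
open import Data.Bool using (Bool; true; false; not)
open import Data.Fin as F using (Fin)
open import Data.Vec as Vec using (Vec; []; _∷_)
import Data.Vec.Properties as VecP
open import Data.List as List using (List; []; _∷_; _++_; concatMap)
import Data.List.Properties as LP
open import Data.List.Relation.Unary.All as All using () renaming (_∷_ to _∷ᴬ_; [] to []ᴬ)
open import Data.List.Relation.Unary.Any using (here; there)
open import Data.Product using (_×_; _,_; Σ; proj₁; proj₂)
open import Data.Sum using (inj₁; inj₂)
open import Function using (id)
open import Data.Empty using (⊥-elim)
open import Relation.Nullary using (¬_; yes; no; does; Dec)
open import Relation.Nullary.Decidable using (dec-true; dec-false; does-⇔)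
open import Function.Bundles using (_⇔_; mk⇔)
import Relation.Binary.PropositionalEquality as P
open P using (_≡_)

infixl 6 _+ᵥ_ _∸ᵥ_

_+ᵥ_ _∸ᵥ_ : ∀ {k} → Vec ℕ k → Vec ℕ k → Vec ℕ k
_+ᵥ_ = Vec.zipWith ℕ._+_
_∸ᵥ_ = Vec.zipWith ℕ._∸_

+ᵥ-identityʳ : ∀ {k} (u : Vec ℕ k) → u +ᵥ Vec.replicate k 0 ≡ u
+ᵥ-identityʳ []      = P.refl
+ᵥ-identityʳ (x ∷ u) = P.cong₂ _∷_ (NP.+-identityʳ x) (+ᵥ-identityʳ u)

+ᵥ≡⇒≡∸ᵥ : ∀ {k} (u v m : Vec ℕ k) → u +ᵥ v ≡ m → v ≡ m ∸ᵥ u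
+ᵥ≡⇒≡∸ᵥ []      []      []      _  = P.refl
+ᵥ≡⇒≡∸ᵥ (x ∷ u) (y ∷ v) (z ∷ m) eq =
  P.cong₂ _∷_ (P.trans (P.sym (NP.m+n∸m≡n x y)) (P.cong (ℕ._∸ x) (VecP.∷-injectiveˡ eq)))
              (+ᵥ≡⇒≡∸ᵥ u v m (VecP.∷-injectiveʳ eq))

+ᵥ≡⇒+ᵥ∸ᵥ≡ : ∀ {k} (u v m : Vec ℕ k) → u +ᵥ v ≡ m → u +ᵥ (m ∸ᵥ u) ≡ m
+ᵥ≡⇒+ᵥ∸ᵥ≡ u v m eq = P.subst (λ w → u +ᵥ w ≡ m) (+ᵥ≡⇒≡∸ᵥ u v m eq) eq

+ᵥ≡⇔≡∸ᵥ : ∀ {k} (u v m : Vec ℕ k) → u +ᵥ (m ∸ᵥ u) ≡ m → (u +ᵥ v ≡ m) ⇔ (v ≡ m ∸ᵥ u)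
+ᵥ≡⇔≡∸ᵥ u v m u+[m∸u]≡m = mk⇔ (+ᵥ≡⇒≡∸ᵥ u v m) (λ v≡m∸u → P.subst (λ w → u +ᵥ w ≡ m) (P.sym v≡m∸u) u+[m∸u]≡m)

pow : ∀ {k} → Fin k → ℕ → Vec ℕ k
pow t j = Vec.updateAt (Vec.replicate _ 0) t (λ _ → j)

pow-zero : ∀ {k} (t : Fin k) → pow t 0 ≡ Vec.replicate k 0
pow-zero F.zero    = P.refl
pow-zero (F.suc t) = P.cong (0 ∷_) (pow-zero t)

∅ : ∀ {k} → Vec Bool k
∅ = Vec.replicate _ false

⁅_⁆ : ∀ {k} → Fin k → Vec Bool k
⁅ t ⁆ = Vec.updateAt ∅ t (λ _ → true)

remove : ∀ {k} → Vec Bool k → Fin k → Vec Bool k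
remove S t = Vec.updateAt S t (λ _ → false)

module _ {c ℓ : Level} (K : CommutativeRing c ℓ) where
  open CommutativeRing K
  open import Relation.Binary.Reasoning.Setoid setoid
  open import Algebra.Properties.CommutativeSemigroup +-commutativeSemigroup using (interchange)
  open import Algebra.Properties.CommutativeSemigroup *-commutativeSemigroup using (x∙yz≈y∙xz)
  open import Algebra.Properties.Semiring.Mult semiring using (×1-homo-*) renaming (_×_ to _×ᴷ_)
  open import Algebra.Properties.Ring ring using (-1*x≈-x)
  open import Algebra.Properties.AbelianGroup +-abelianGroup using (//-rightDividesʳ)

  private variable
    a : Level
    A B : Set a

  sumOver : List A → (A → Carrier) → Carrier
  sumOver []       g = 0#
  sumOver (x ∷ xs) g = g x + sumOver xs g

  infix 6.5 sumOver
  syntax sumOver xs (λ x → e) = ∑[ x ∈ xs ] e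

  ∑-cong : ∀ (xs : List A) {g h : A → Carrier} → (∀ x → g x ≈ h x) → sumOver xs g ≈ sumOver xs h
  ∑-cong []       g≈h = refl
  ∑-cong (x ∷ xs) g≈h = +-cong (g≈h x) (∑-cong xs g≈h)

  ∑-zero : ∀ (xs : List A) → ∑[ x ∈ xs ] 0# ≈ 0#
  ∑-zero []       = refl
  ∑-zero (x ∷ xs) = trans (+-identityˡ _) (∑-zero xs)

  ∑-++ : ∀ (xs ys : List A) g → sumOver (xs ++ ys) g ≈ sumOver xs g + sumOver ys g
  ∑-++ []       ys g = sym (+-identityˡ _)
  ∑-++ (x ∷ xs) ys g = trans (+-congˡ (∑-++ xs ys g)) (sym (+-assoc _ _ _))

  ∑-+ : ∀ (xs : List A) g h → ∑[ x ∈ xs ] (g x + h x) ≈ sumOver xs g + sumOver xs h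
  ∑-+ []       g h = sym (+-identityˡ _)
  ∑-+ (x ∷ xs) g h = trans (+-congˡ (∑-+ xs g h)) (interchange _ _ _ _)

  ∑-*ˡ : ∀ (xs : List A) k g → ∑[ x ∈ xs ] (k * g x) ≈ k * sumOver xs g
  ∑-*ˡ []       k g = sym (zeroʳ k)
  ∑-*ˡ (x ∷ xs) k g = trans (+-congˡ (∑-*ˡ xs k g)) (sym (distribˡ k _ _))

  ∑-map : ∀ (f : A → B) (xs : List A) g → sumOver (List.map f xs) g ≈ ∑[ x ∈ xs ] g (f x)
  ∑-map f []       g = refl
  ∑-map f (x ∷ xs) g = +-congˡ (∑-map f xs g)

  ∑-comm : ∀ (xs : List A) (ys : List B) (g : A → B → Carrier) →
           ∑[ x ∈ xs ] ∑[ y ∈ ys ] g x y ≈ ∑[ y ∈ ys ] ∑[ x ∈ xs ] g x y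
  ∑-comm []       ys g = sym (∑-zero ys)
  ∑-comm (x ∷ xs) ys g = trans (+-congˡ (∑-comm xs ys g)) (sym (∑-+ ys (g x) _))

  ∑-concatMap : ∀ (f : A → List B) (xs : List A) g →
                sumOver (concatMap f xs) g ≈ ∑[ x ∈ xs ] sumOver (f x) g
  ∑-concatMap f []       g = refl
  ∑-concatMap f (x ∷ xs) g = trans (∑-++ (f x) (concatMap f xs) g) (+-congˡ (∑-concatMap f xs g))

  ∑-allFin-suc : ∀ k (g : Fin (suc k) → Carrier) →
                 ∑[ t ∈ List.allFin (suc k) ] g t ≈ g F.zero + ∑[ t ∈ List.allFin k ] g (F.suc t)
  ∑-allFin-suc k g = +-congˡ (begin
    sumOver (List.tabulate F.suc) g                ≡⟨ P.cong (λ ts → sumOver ts g) (LP.map-tabulate id F.suc) ⟨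
    sumOver (List.map F.suc (List.allFin k)) g     ≈⟨ ∑-map F.suc (List.allFin k) g ⟩
    ∑[ t ∈ List.allFin k ] g (F.suc t)             ∎)

  when : Bool → Carrier → Carrier
  when true  x = x
  when false x = 0#

  when-cong : ∀ b {x y} → x ≈ y → when b x ≈ when b y
  when-cong true  x≈y = x≈y
  when-cong false x≈y = refl

  when-zero : ∀ b → when b 0# ≈ 0#
  when-zero true  = refl
  when-zero false = refl

  when-false : ∀ {b} x → b ≡ false → when b x ≈ 0#
  when-false x P.refl = refl

  when-*ˡ : ∀ b a x → when b (a * x) ≈ a * when b x
  when-*ˡ true  a x = refl
  when-*ˡ false a x = sym (zeroʳ a)

  when-comm : ∀ a b x → when a (when b x) ≡ when b (when a x)
  when-comm true  true  x = P.refl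
  when-comm true  false x = P.refl
  when-comm false true  x = P.refl
  when-comm false false x = P.refl

  when-split : ∀ a b x → when a x ≈ when a (when b x) + when a (when (not b) x)
  when-split false b     x = sym (+-identityˡ _)
  when-split true  true  x = sym (+-identityʳ _)
  when-split true  false x = sym (+-identityˡ _)

  when-∑ : ∀ (xs : List A) b g → when b (sumOver xs g) ≈ ∑[ x ∈ xs ] when b (g x)
  when-∑ xs true  g = refl
  when-∑ xs false g = sym (∑-zero xs)

  ∑-filter : ∀ {p} {Q : A → Set p} (Q? : ∀ x → Dec (Q x)) (xs : List A) g →
             sumOver (List.filter Q? xs) g ≈ ∑[ x ∈ xs ] when (does (Q? x)) (g x)
  ∑-filter Q? []       g = refl
  ∑-filter Q? (x ∷ xs) g with does (Q? x)
  ... | true  = +-congˡ (∑-filter Q? xs g)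
  ... | false = trans (∑-filter Q? xs g) (sym (+-identityˡ _))

  x≈y+z⇒x-z≈y : ∀ {x y z} → x ≈ y + z → x - z ≈ y
  x≈y+z⇒x-z≈y {y = y} {z} x≈y+z = trans (+-congʳ x≈y+z) (//-rightDividesʳ z y)

  natCast-* : ∀ m k → natCast K (m ℕ.* k) ≈ natCast K m * natCast K k
  natCast-* m k = begin
    natCast K (m ℕ.* k)          ≡⟨ natCast≡×1 (m ℕ.* k) ⟩
    (m ℕ.* k) ×ᴷ 1#              ≈⟨ ×1-homo-* m k ⟩
    (m ×ᴷ 1#) * (k ×ᴷ 1#)        ≡⟨ P.cong₂ _*_ (natCast≡×1 m) (natCast≡×1 k) ⟨
    natCast K m * natCast K k    ∎
    where
    natCast≡×1 : ∀ m → natCast K m ≡ m ×ᴷ 1#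
    natCast≡×1 zero    = P.refl
    natCast≡×1 (suc m) = P.cong (1# +_) (natCast≡×1 m)

  -- Characteristic of a field

  module _ (isField : IsField K) where
    open IsField isField

    zero-product : ∀ {x y} → x * y ≈ 0# → ¬ x ≈ 0# → y ≈ 0#
    zero-product {x} {y} xy≈0 x≉0 with inverse x x≉0
    ... | x⁻¹ , xx⁻¹≈1 = begin
      y                ≈⟨ *-identityˡ y ⟨
      1# * y           ≈⟨ *-congʳ (trans (sym xx⁻¹≈1) (*-comm x x⁻¹)) ⟩
      (x⁻¹ * x) * y    ≈⟨ *-assoc x⁻¹ x y ⟩
      x⁻¹ * (x * y)    ≈⟨ *-congˡ xy≈0 ⟩
      x⁻¹ * 0#         ≈⟨ zeroʳ x⁻¹ ⟩
      0#               ∎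

    module _ {r : ℕ} (char : HasCharacteristic K r) where
      open HasCharacteristic char

      instance
        r≢0 : NonZero r
        r≢0 = ℕ.>-nonZero r-pos

      cofactor-of-proper-factor : ∀ q d → r ≡ q ℕ.* d → d < r → q ≡ r
      cofactor-of-proper-factor q d r≡q*d d<r =
        NP.≤-antisym (∣⇒≤ (divides d (P.trans r≡q*d (NP.*-comm q d))))
                     (NP.≮⇒≥ λ q<r → r-least q 0<q q<r natCast[q]≈0)
        where
        0<q : 0 < q
        0<q = NP.n≢0⇒n>0 λ { P.refl → NP.<⇒≢ r-pos (P.sym r≡q*d) }
        0<d : 0 < d
        0<d = NP.n≢0⇒n>0 λ { P.refl → NP.<⇒≢ r-pos (P.sym (P.trans r≡q*d (NP.*-zeroʳ q))) }
        natCast[q]≈0 : natCast K q ≈ 0#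
        natCast[q]≈0 = zero-product
          (begin
            natCast K d * natCast K q    ≈⟨ *-comm _ _ ⟩
            natCast K q * natCast K d    ≈⟨ natCast-* q d ⟨
            natCast K (q ℕ.* d)          ≡⟨ P.cong (natCast K) r≡q*d ⟨
            natCast K r                  ≈⟨ r-kills ⟩
            0#                           ∎)
          (r-least d 0<d d<r)

      char-irreducible : Irreducible r
      char-irreducible {d} d∣r@(divides q r≡q*d) with NP.m≤n⇒m<n∨m≡n (∣⇒≤ d∣r)
      ... | inj₂ d≡r = inj₂ d≡r
      ... | inj₁ d<r = inj₁ (NP.*-cancelˡ-≡ d 1 r
        (P.trans (P.cong (ℕ._* d) (P.sym (cofactor-of-proper-factor q d r≡q*d d<r)))
                 (P.trans (P.sym r≡q*d) (P.sym (NP.*-identityʳ r)))))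

      natCast-multiple-of-char : ∀ {k} → r ∣ k → natCast K k ≈ 0#
      natCast-multiple-of-char {k} (divides q k≡q*r) = begin
        natCast K k                  ≡⟨ P.cong (natCast K) k≡q*r ⟩
        natCast K (q ℕ.* r)          ≈⟨ natCast-* q r ⟩
        natCast K q * natCast K r    ≈⟨ *-congˡ r-kills ⟩
        natCast K q * 0#             ≈⟨ zeroʳ _ ⟩
        0#                           ∎

      natCast-not-coprime : ∀ k → ¬ Coprime k r → natCast K k ≈ 0#
      natCast-not-coprime k ¬coprime with char-irreducible (gcd[m,n]∣n k r)
      ... | inj₁ gcd≡1 = ⊥-elim (¬coprime (gcd≡1⇒coprime gcd≡1))
      ... | inj₂ gcd≡r = natCast-multiple-of-char (P.subst (_∣ k) gcd≡r (gcd[m,n]∣m k r))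

  module _ (n : ℕ) where
    open Poly K n

    _==_ : Monomial → Monomial → Bool
    u == m = does (VecP.≡-dec ℕ._≟_ u m)

    termCoeff : Term → Monomial → Carrier
    termCoeff (a , u) m = when (u == m) a

    _*ₜ_ : Term → Term → Term
    (a , u) *ₜ (b , v) = (a * b , u +ᵥ v)

    coeff-∷ : ∀ t f m → coeff (t ∷ f) m ≈ termCoeff t m + coeff f m
    coeff-∷ (a , u) f m with VecP.≡-dec ℕ._≟_ u m
    ... | yes _ = refl
    ... | no  _ = sym (+-identityˡ _)

    coeff≈∑ : ∀ f m → coeff f m ≈ ∑[ t ∈ f ] termCoeff t m
    coeff≈∑ []      m = refl
    coeff≈∑ (t ∷ f) m = trans (coeff-∷ t f m) (+-congˡ (coeff≈∑ f m))

    coeff-⊕ : ∀ f g m → coeff (f ⊕ g) m ≈ coeff f m + coeff g m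
    coeff-⊕ f g m = begin
      coeff (f ++ g) m                                           ≈⟨ coeff≈∑ (f ++ g) m ⟩
      ∑[ t ∈ f ++ g ] termCoeff t m                              ≈⟨ ∑-++ f g _ ⟩
      ∑[ t ∈ f ] termCoeff t m + ∑[ t ∈ g ] termCoeff t m        ≈⟨ +-cong (coeff≈∑ f m) (coeff≈∑ g m) ⟨
      coeff f m + coeff g m                                      ∎

    coeff-· : ∀ a f m → coeff (a · f) m ≈ a * coeff f m
    coeff-· a f m = begin
      coeff (a · f) m                                  ≈⟨ coeff≈∑ (a · f) m ⟩
      ∑[ t ∈ a · f ] termCoeff t m                     ≈⟨ ∑-map _ f _ ⟩
      ∑[ t ∈ f ] when (proj₂ t == m) (a * proj₁ t)     ≈⟨ ∑-cong f (λ t → when-*ˡ (proj₂ t == m) a (proj₁ t)) ⟩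
      ∑[ t ∈ f ] a * termCoeff t m                     ≈⟨ ∑-*ˡ f a _ ⟩
      a * (∑[ t ∈ f ] termCoeff t m)                   ≈⟨ *-congˡ (coeff≈∑ f m) ⟨
      a * coeff f m                                    ∎

    coeff-⊗ : ∀ f g m → coeff (f ⊗ g) m ≈ ∑[ s ∈ f ] ∑[ t ∈ g ] termCoeff (s *ₜ t) m
    coeff-⊗ f g m =
      trans (coeff≈∑ (f ⊗ g) m) (trans (∑-concatMap _ f _) (∑-cong f (λ { (a , u) → ∑-map _ g _ })))

    _∣ᵐ_ : Monomial → Monomial → Bool
    u ∣ᵐ m = (u +ᵥ (m ∸ᵥ u)) == m

    ∑-term-*ₜ : ∀ a u g m → ∑[ t ∈ g ] termCoeff ((a , u) *ₜ t) m ≈ when (u ∣ᵐ m) (a * coeff g (m ∸ᵥ u))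
    ∑-term-*ₜ a u g m with VecP.≡-dec ℕ._≟_ (u +ᵥ (m ∸ᵥ u)) m
    ... | yes u∣m = begin
      ∑[ t ∈ g ] when ((u +ᵥ proj₂ t) == m) (a * proj₁ t)
        ≈⟨ ∑-cong g (λ { (b , v) → reflexive (P.cong (λ z → when z (a * b))
             (does-⇔ (+ᵥ≡⇔≡∸ᵥ u v m u∣m) (VecP.≡-dec ℕ._≟_ (u +ᵥ v) m) (VecP.≡-dec ℕ._≟_ v (m ∸ᵥ u)))) }) ⟩
      ∑[ t ∈ g ] when (proj₂ t == (m ∸ᵥ u)) (a * proj₁ t)      ≈⟨ ∑-cong g (λ t → when-*ˡ (proj₂ t == (m ∸ᵥ u)) a (proj₁ t)) ⟩
      ∑[ t ∈ g ] a * termCoeff t (m ∸ᵥ u)                      ≈⟨ ∑-*ˡ g a _ ⟩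
      a * (∑[ t ∈ g ] termCoeff t (m ∸ᵥ u))                    ≈⟨ *-congˡ (coeff≈∑ g (m ∸ᵥ u)) ⟨
      a * coeff g (m ∸ᵥ u)                                     ∎
    ... | no u∤m = trans (∑-cong g (λ { (b , v) → when-false (a * b)
                           (dec-false (VecP.≡-dec ℕ._≟_ (u +ᵥ v) m) (λ u+v≡m → u∤m (+ᵥ≡⇒+ᵥ∸ᵥ≡ u v m u+v≡m))) }))
                         (∑-zero g)

    ⊗-congˡ : ∀ q {f g} → f ≋ g → (q ⊗ f) ≋ (q ⊗ g)
    ⊗-congˡ q {f} {g} f≋g m = begin
      coeff (q ⊗ f) m                             ≈⟨ coeff-⊗ q f m ⟩
      ∑[ s ∈ q ] ∑[ t ∈ f ] termCoeff (s *ₜ t) m  ≈⟨ ∑-cong q (λ { (a , u) → begin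
          _                                     ≈⟨ ∑-term-*ₜ a u f m ⟩
          when (u ∣ᵐ m) (a * coeff f (m ∸ᵥ u))  ≈⟨ when-cong (u ∣ᵐ m) (*-congˡ (f≋g (m ∸ᵥ u))) ⟩
          when (u ∣ᵐ m) (a * coeff g (m ∸ᵥ u))  ≈⟨ ∑-term-*ₜ a u g m ⟨
          _                                     ∎ }) ⟩
      ∑[ s ∈ q ] ∑[ t ∈ g ] termCoeff (s *ₜ t) m  ≈⟨ coeff-⊗ q g m ⟨
      coeff (q ⊗ g) m                             ∎

    ⊗-zeroʳ : ∀ q → (q ⊗ zeroP) ≋ zeroP
    ⊗-zeroʳ q m = trans (coeff-⊗ q [] m) (∑-zero q)

    ⊗-identityʳ : ∀ q → (q ⊗ oneP) ≋ q
    ⊗-identityʳ q m = begin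
      coeff (q ⊗ oneP) m                                ≈⟨ coeff-⊗ q oneP m ⟩
      ∑[ s ∈ q ] (termCoeff (s *ₜ (1# , Vec.replicate n 0)) m + 0#)
        ≈⟨ ∑-cong q (λ { (a , u) → trans (+-identityʳ _)
             (reflexive (P.cong₂ (λ v b → when (v == m) b) (+ᵥ-identityʳ u) P.refl)) }) ⟩
      ∑[ s ∈ q ] when (proj₂ s == m) (proj₁ s * 1#)    ≈⟨ ∑-cong q (λ s → when-cong (proj₂ s == m) (*-identityʳ _)) ⟩
      ∑[ s ∈ q ] termCoeff s m                         ≈⟨ coeff≈∑ q m ⟨
      coeff q m                                        ∎

    ⊗-distribˡ-⊕ : ∀ q f g → (q ⊗ (f ⊕ g)) ≋ ((q ⊗ f) ⊕ (q ⊗ g))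
    ⊗-distribˡ-⊕ q f g m = begin
      coeff (q ⊗ (f ++ g)) m                                                              ≈⟨ coeff-⊗ q (f ++ g) m ⟩
      ∑[ s ∈ q ] ∑[ t ∈ f ++ g ] termCoeff (s *ₜ t) m                                     ≈⟨ ∑-cong q (λ s → ∑-++ f g _) ⟩
      ∑[ s ∈ q ] (∑[ t ∈ f ] termCoeff (s *ₜ t) m + ∑[ t ∈ g ] termCoeff (s *ₜ t) m)      ≈⟨ ∑-+ q _ _ ⟩
      _                                                                                   ≈⟨ +-cong (coeff-⊗ q f m) (coeff-⊗ q g m) ⟨
      coeff (q ⊗ f) m + coeff (q ⊗ g) m                                                   ≈⟨ coeff-⊕ (q ⊗ f) (q ⊗ g) m ⟨
      coeff ((q ⊗ f) ⊕ (q ⊗ g)) m                                                         ∎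

    ⊗-·-comm : ∀ q a f → (q ⊗ (a · f)) ≋ (a · (q ⊗ f))
    ⊗-·-comm q a f m = begin
      coeff (q ⊗ (a · f)) m                                        ≈⟨ coeff-⊗ q (a · f) m ⟩
      ∑[ s ∈ q ] ∑[ t ∈ a · f ] termCoeff (s *ₜ t) m               ≈⟨ ∑-cong q (λ s → ∑-map _ f _) ⟩
      ∑[ s ∈ q ] ∑[ t ∈ f ] termCoeff (s *ₜ (a * proj₁ t , proj₂ t)) m
        ≈⟨ ∑-cong q (λ { (b , u) → ∑-cong f (λ { (d , v) →
             trans (when-cong ((u +ᵥ v) == m) (x∙yz≈y∙xz b a d)) (when-*ˡ ((u +ᵥ v) == m) a (b * d)) }) }) ⟩
      ∑[ s ∈ q ] ∑[ t ∈ f ] a * termCoeff (s *ₜ t) m               ≈⟨ ∑-cong q (λ s → ∑-*ˡ f a _) ⟩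
      ∑[ s ∈ q ] a * (∑[ t ∈ f ] termCoeff (s *ₜ t) m)             ≈⟨ ∑-*ˡ q a _ ⟩
      a * (∑[ s ∈ q ] ∑[ t ∈ f ] termCoeff (s *ₜ t) m)             ≈⟨ *-congˡ (coeff-⊗ q f m) ⟨
      a * coeff (q ⊗ f) m                                          ≈⟨ coeff-· a (q ⊗ f) m ⟨
      coeff (a · (q ⊗ f)) m                                        ∎

    -- Newton's identities

    size≤ : ∀ {k} (S : Vec Bool k) → size S ≤ k
    size≤ []          = z≤n
    size≤ (true  ∷ S) = s≤s (size≤ S)
    size≤ (false ∷ S) = NP.m≤n⇒m≤1+n (size≤ S)

    e-vanishes : ∀ i → n < i → e i ≡ []
    e-vanishes i n<i = P.cong (List.map _) (LP.filter-none (λ S → size S ℕ.≟ i)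
      (All.universal (λ S size≡i → NP.<⇒≱ n<i (P.subst (_≤ n) size≡i (size≤ S))) (subsets n)))

    hasSize : ∀ {k} → Vec Bool k → ℕ → Bool
    hasSize S i = does (size S ℕ.≟ i)

    size-remove : ∀ {k} (S : Vec Bool k) t → Vec.lookup S t ≡ true → size S ≡ suc (size (remove S t))
    size-remove (true  ∷ S) F.zero    _  = P.refl
    size-remove (true  ∷ S) (F.suc t) t∈S = P.cong suc (size-remove S t t∈S)
    size-remove (false ∷ S) (F.suc t) t∈S = size-remove S t t∈S

    indicator-remove : ∀ {k} (S : Vec Bool k) t j → Vec.lookup S t ≡ true →
                       indicator (remove S t) +ᵥ pow t (suc j) ≡ indicator S +ᵥ pow t j
    indicator-remove (true ∷ S) F.zero    j _   = P.refl
    indicator-remove (b    ∷ S) (F.suc t) j t∈S = P.cong (_ ∷_) (indicator-remove S t j t∈S)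

    indicator-⁅⁆ : ∀ {k} (t : Fin k) j → indicator ⁅ t ⁆ +ᵥ pow t j ≡ pow t (suc j)
    indicator-⁅⁆ {suc k} F.zero    j = P.cong (suc j ∷_)
      (P.trans (P.cong (_+ᵥ Vec.replicate k 0) (VecP.map-replicate _ false k)) (+ᵥ-identityʳ _))
    indicator-⁅⁆         (F.suc t) j = P.cong (0 ∷_) (indicator-⁅⁆ t j)

    ∑-subsets-suc : ∀ k (h : Vec Bool (suc k) → Carrier) →
                    ∑[ S ∈ subsets (suc k) ] h S ≈ ∑[ S ∈ subsets k ] h (true ∷ S) + ∑[ S ∈ subsets k ] h (false ∷ S)
    ∑-subsets-suc k h = trans (∑-++ (List.map (true ∷_) (subsets k)) _ h) (+-cong (∑-map _ (subsets k) h) (∑-map _ (subsets k) h))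

    ∑-absent≈∑-present : ∀ {k} (t : Fin k) (h : Vec Bool k → Carrier) →
                         ∑[ S ∈ subsets k ] when (not (Vec.lookup S t)) (h S) ≈ ∑[ S ∈ subsets k ] when (Vec.lookup S t) (h (remove S t))
    ∑-absent≈∑-present {suc k} F.zero h = begin
      _                                                         ≈⟨ ∑-subsets-suc k _ ⟩
      ∑[ S ∈ subsets k ] 0# + ∑[ S ∈ subsets k ] h (false ∷ S)  ≈⟨ +-comm _ _ ⟩
      ∑[ S ∈ subsets k ] h (false ∷ S) + ∑[ S ∈ subsets k ] 0#  ≈⟨ ∑-subsets-suc k _ ⟨
      _                                                         ∎
    ∑-absent≈∑-present {suc k} (F.suc t) h = begin
      _   ≈⟨ ∑-subsets-suc k _ ⟩
      _   ≈⟨ +-cong (∑-absent≈∑-present t (λ S → h (true ∷ S))) (∑-absent≈∑-present t (λ S → h (false ∷ S))) ⟩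
      _   ≈⟨ ∑-subsets-suc k _ ⟨
      _   ∎

    ∑-size≡0 : ∀ k (h : Vec Bool k → Carrier) → ∑[ S ∈ subsets k ] when (hasSize S 0) (h S) ≈ h ∅
    ∑-size≡0 zero    h = +-identityʳ _
    ∑-size≡0 (suc k) h = begin
      _                                                                        ≈⟨ ∑-subsets-suc k _ ⟩
      ∑[ S ∈ subsets k ] 0# + ∑[ S ∈ subsets k ] when (hasSize S 0) (h (false ∷ S))
        ≈⟨ +-cong (∑-zero (subsets k)) (∑-size≡0 k (λ S → h (false ∷ S))) ⟩
      0# + h (false ∷ ∅)                                                       ≈⟨ +-identityˡ _ ⟩
      h ∅                                                                      ∎

    ∑-size≡1-∋ : ∀ {k} (t : Fin k) (h : Vec Bool k → Carrier) →
                 ∑[ S ∈ subsets k ] when (hasSize S 1) (when (Vec.lookup S t) (h S)) ≈ h ⁅ t ⁆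
    ∑-size≡1-∋ {suc k} F.zero h = begin
      _                                                        ≈⟨ ∑-subsets-suc k _ ⟩
      ∑[ S ∈ subsets k ] when (hasSize S 0) (h (true ∷ S)) + ∑[ S ∈ subsets k ] when (hasSize S 1) 0#
        ≈⟨ +-cong (∑-size≡0 k (λ S → h (true ∷ S))) (trans (∑-cong (subsets k) (λ S → when-zero (hasSize S 1))) (∑-zero (subsets k))) ⟩
      h (true ∷ ∅) + 0#                                        ≈⟨ +-identityʳ _ ⟩
      h ⁅ F.zero ⁆                                             ∎
    ∑-size≡1-∋ {suc k} (F.suc t) h = begin
      _   ≈⟨ ∑-subsets-suc k _ ⟩
      ∑[ S ∈ subsets k ] when (hasSize S 0) (when (Vec.lookup S t) (h (true ∷ S)))
        + ∑[ S ∈ subsets k ] when (hasSize S 1) (when (Vec.lookup S t) (h (false ∷ S)))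
          ≈⟨ +-cong (trans (∑-size≡0 k (λ S → when (Vec.lookup S t) (h (true ∷ S)))) (when-false _ (VecP.lookup-replicate t false)))
                    (∑-size≡1-∋ t (λ S → h (false ∷ S))) ⟩
      0# + h (false ∷ ⁅ t ⁆)   ≈⟨ +-identityˡ _ ⟩
      h ⁅ F.suc t ⁆            ∎

    ∑-lookup : ∀ {k} (S : Vec Bool k) x → ∑[ t ∈ List.allFin k ] when (Vec.lookup S t) x ≈ natCast K (size S) * x
    ∑-lookup []               x = sym (zeroˡ x)
    ∑-lookup {suc k} (true ∷ S) x = begin
      _                                      ≈⟨ ∑-allFin-suc k _ ⟩
      x + ∑[ t ∈ List.allFin k ] when (Vec.lookup S t) x  ≈⟨ +-cong (*-identityˡ x) (sym (∑-lookup S x)) ⟨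
      1# * x + natCast K (size S) * x        ≈⟨ distribʳ x 1# _ ⟨
      (1# + natCast K (size S)) * x          ∎
    ∑-lookup {suc k} (false ∷ S) x = trans (∑-allFin-suc k _) (trans (+-identityˡ _) (∑-lookup S x))

    -- mixed i j P m is the coefficient of x^m in Σ_{|S|=i} Σ_{t : P (t ∈ S)} x_S x_t^j.
    mixed : ℕ → ℕ → (Bool → Bool) → Monomial → Carrier
    mixed i j P m = ∑[ S ∈ subsets n ] ∑[ t ∈ List.allFin n ]
                      when (hasSize S i) (when (P (Vec.lookup S t)) (termCoeff (1# , indicator S +ᵥ pow t j) m))

    e⊗p≈mixed : ∀ i j m → coeff (e i ⊗ p j) m ≈ mixed i j (λ _ → true) m
    e⊗p≈mixed i j m = begin
      coeff (e i ⊗ p j) m                                                    ≈⟨ coeff-⊗ (e i) (p j) m ⟩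
      ∑[ s ∈ e i ] ∑[ t ∈ p j ] termCoeff (s *ₜ t) m                         ≈⟨ ∑-map _ (List.filter (λ S → size S ℕ.≟ i) (subsets n)) _ ⟩
      _                                                                      ≈⟨ ∑-filter (λ S → size S ℕ.≟ i) (subsets n) _ ⟩
      ∑[ S ∈ subsets n ] when (hasSize S i) (∑[ t ∈ p j ] termCoeff ((1# , indicator S) *ₜ t) m)
        ≈⟨ ∑-cong (subsets n) (λ S → trans (when-cong (hasSize S i) (∑-map _ (List.allFin n) _)) (when-∑ (List.allFin n) (hasSize S i) _)) ⟩
      ∑[ S ∈ subsets n ] ∑[ t ∈ List.allFin n ] when (hasSize S i) (termCoeff (1# * 1# , indicator S +ᵥ pow t j) m)
        ≈⟨ ∑-cong (subsets n) (λ S → ∑-cong (List.allFin n) (λ t → when-cong (hasSize S i) (when-cong ((indicator S +ᵥ pow t j) == m) (*-identityˡ 1#)))) ⟩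
      mixed i j (λ _ → true) m                                               ∎

    mixed-split : ∀ i j m → mixed i j (λ _ → true) m ≈ mixed i j id m + mixed i j not m
    mixed-split i j m = trans (∑-cong (subsets n) (λ S →
        trans (∑-cong (List.allFin n) (λ t → when-split (hasSize S i) (Vec.lookup S t) _)) (∑-+ (List.allFin n) _ _)))
      (∑-+ (subsets n) _ _)

    mixed-absent-suc : ∀ i j m → mixed i (suc j) not m ≈ mixed (suc i) j id m
    mixed-absent-suc i j m = begin
      mixed i (suc j) not m                                  ≈⟨ ∑-comm (subsets n) (List.allFin n) _ ⟩
      ∑[ t ∈ List.allFin n ] ∑[ S ∈ subsets n ] when (hasSize S i) (when (not (Vec.lookup S t)) (g S t (suc j)))
        ≈⟨ ∑-cong (List.allFin n) (λ t → begin
             _  ≈⟨ ∑-cong (subsets n) (λ S → reflexive (when-comm (hasSize S i) (not (Vec.lookup S t)) _)) ⟩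
             _  ≈⟨ ∑-absent≈∑-present t (λ S → when (hasSize S i) (g S t (suc j))) ⟩
             _  ≈⟨ ∑-cong (subsets n) (present t) ⟩
             _  ≈⟨ ∑-cong (subsets n) (λ S → reflexive (when-comm (Vec.lookup S t) (hasSize S (suc i)) _)) ⟩
             ∑[ S ∈ subsets n ] when (hasSize S (suc i)) (when (Vec.lookup S t) (g S t j))  ∎) ⟩
      _                                                      ≈⟨ ∑-comm (subsets n) (List.allFin n) _ ⟨
      mixed (suc i) j id m                                   ∎
      where
      g : Vec Bool n → Fin n → ℕ → Carrier
      g S t j = termCoeff (1# , indicator S +ᵥ pow t j) m
      present : ∀ t S → when (Vec.lookup S t) (when (hasSize (remove S t) i) (g (remove S t) t (suc j)))
                        ≈ when (Vec.lookup S t) (when (hasSize S (suc i)) (g S t j))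
      present t S with Vec.lookup S t in t∈S
      ... | false = refl
      ... | true  = reflexive (P.cong₂ when (P.cong (λ z → does (z ℕ.≟ suc i)) (P.sym (size-remove S t t∈S)))
                                            (P.cong (λ z → termCoeff (1# , z) m) (indicator-remove S t j t∈S)))

    mixed-1≈p : ∀ k m → mixed 1 k id m ≈ coeff (p (suc k)) m
    mixed-1≈p k m = begin
      mixed 1 k id m                                             ≈⟨ ∑-comm (subsets n) (List.allFin n) _ ⟩
      _                                                          ≈⟨ ∑-cong (List.allFin n) (λ t → ∑-size≡1-∋ t (λ S → termCoeff (1# , indicator S +ᵥ pow t k) m)) ⟩
      ∑[ t ∈ List.allFin n ] termCoeff (1# , indicator ⁅ t ⁆ +ᵥ pow t k) m
        ≈⟨ ∑-cong (List.allFin n) (λ t → reflexive (P.cong (λ z → termCoeff (1# , z) m) (indicator-⁅⁆ t k))) ⟩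
      ∑[ t ∈ List.allFin n ] termCoeff (1# , pow t (suc k)) m    ≈⟨ ∑-map _ (List.allFin n) _ ⟨
      ∑[ t ∈ p (suc k) ] termCoeff t m                           ≈⟨ coeff≈∑ (p (suc k)) m ⟨
      coeff (p (suc k)) m                                        ∎

    mixed-0≈e : ∀ k m → mixed k 0 id m ≈ natCast K k * coeff (e k) m
    mixed-0≈e k m = begin
      mixed k 0 id m
        ≈⟨ ∑-cong (subsets n) (λ S → ∑-cong (List.allFin n) (λ t → reflexive
             (P.cong (λ z → when (hasSize S k) (when (Vec.lookup S t) (termCoeff (1# , z) m)))
                     (P.trans (P.cong (indicator S +ᵥ_) (pow-zero t)) (+ᵥ-identityʳ (indicator S)))))) ⟩
      ∑[ S ∈ subsets n ] ∑[ t ∈ List.allFin n ] when (hasSize S k) (when (Vec.lookup S t) (termCoeff (1# , indicator S) m))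
        ≈⟨ ∑-cong (subsets n) (λ S → trans (sym (when-∑ (List.allFin n) (hasSize S k) _))
             (trans (when-cong (hasSize S k) (∑-lookup S _)) (when-size S))) ⟩
      ∑[ S ∈ subsets n ] natCast K k * when (hasSize S k) (termCoeff (1# , indicator S) m)
        ≈⟨ ∑-*ˡ (subsets n) (natCast K k) _ ⟩
      natCast K k * (∑[ S ∈ subsets n ] when (hasSize S k) (termCoeff (1# , indicator S) m))
        ≈⟨ *-congˡ (∑-filter (λ S → size S ℕ.≟ k) (subsets n) _) ⟨
      natCast K k * (∑[ S ∈ List.filter (λ S → size S ℕ.≟ k) (subsets n) ] termCoeff (1# , indicator S) m)
        ≈⟨ *-congˡ (trans (coeff≈∑ (e k) m) (∑-map _ (List.filter (λ S → size S ℕ.≟ k) (subsets n)) _)) ⟨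
      natCast K k * coeff (e k) m                                ∎
      where
      when-size : ∀ S {x} → when (hasSize S k) (natCast K (size S) * x) ≈ natCast K k * when (hasSize S k) x
      when-size S with size S ℕ.≟ k
      ... | yes size≡k rewrite dec-true (size S ℕ.≟ k) size≡k = *-congʳ (reflexive (P.cong (natCast K) size≡k))
      ... | no  size≢k rewrite dec-false (size S ℕ.≟ k) size≢k = sym (zeroʳ _)

    newton-step : ∀ i j m → coeff (e i ⊗ p (suc j)) m ≈ mixed i (suc j) id m + mixed (suc i) j id m
    newton-step i j m = begin
      coeff (e i ⊗ p (suc j)) m                            ≈⟨ e⊗p≈mixed i (suc j) m ⟩
      mixed i (suc j) (λ _ → true) m                       ≈⟨ mixed-split i (suc j) m ⟩
      mixed i (suc j) id m + mixed i (suc j) not m         ≈⟨ +-congˡ (mixed-absent-suc i j m) ⟩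
      mixed i (suc j) id m + mixed (suc i) j id m          ∎

    -- Subalgebras and the span of the e_λ

    InSubalg-least : ∀ {i j} {I : Set i} {J : Set j} {g : I → Pol} {h : J → Pol} →
                     (∀ x → InSubalg h (g x)) → ∀ {f} → InSubalg g f → InSubalg h f
    InSubalg-least g⊆h (gen x)    = g⊆h x
    InSubalg-least g⊆h (scalar a) = scalar a
    InSubalg-least g⊆h (add x y)  = add (InSubalg-least g⊆h x) (InSubalg-least g⊆h y)
    InSubalg-least g⊆h (mul x y)  = mul (InSubalg-least g⊆h x) (InSubalg-least g⊆h y)
    InSubalg-least g⊆h (smul a x) = smul a (InSubalg-least g⊆h x)
    InSubalg-least g⊆h (resp eq x) = resp eq (InSubalg-least g⊆h x)

    module _ (r : ℕ) where

      Combination : Set c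
      Combination = List (Carrier × GoodPartition r)

      ⟦_⟧ : Combination → Pol
      ⟦ [] ⟧          = zeroP
      ⟦ (a , λp) ∷ L ⟧ = (a · eλ (GoodPartition.parts λp)) ⊕ ⟦ L ⟧

      -- Unlike E, which contains the constants, this span is closed under multiplication
      -- by every e_i.
      Spanned : (Monomial → Carrier) → Set (c ⊔ ℓ)
      Spanned φ = Σ Combination λ L → ∀ m → coeff ⟦ L ⟧ m ≈ φ m

      ⟦⟧-InE : ∀ L → InE r ⟦ L ⟧
      ⟦⟧-InE []             = resp (λ m → trans (coeff-∷ (0# , Vec.replicate n 0) [] m) (trans (+-identityʳ _) (when-zero (Vec.replicate n 0 == m)))) (scalar 0#)
      ⟦⟧-InE ((a , λp) ∷ L) = add (smul a (gen λp)) (⟦⟧-InE L)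

      Spanned⇒InE : ∀ {f} → Spanned (coeff f) → InE r f
      Spanned⇒InE (L , ⟦L⟧≋f) = resp ⟦L⟧≋f (⟦⟧-InE L)

      Spanned-resp : ∀ {φ ψ} → (∀ m → φ m ≈ ψ m) → Spanned φ → Spanned ψ
      Spanned-resp φ≈ψ (L , ⟦L⟧≈φ) = L , λ m → trans (⟦L⟧≈φ m) (φ≈ψ m)

      Spanned-zero : Spanned (λ _ → 0#)
      Spanned-zero = [] , λ _ → refl

      Spanned-generator : ∀ λp → Spanned (coeff (eλ (GoodPartition.parts λp)))
      Spanned-generator λp = ((1# , λp) ∷ []) , λ m → begin
        coeff ((1# · eλ parts) ⊕ []) m    ≈⟨ coeff-⊕ (1# · eλ parts) [] m ⟩
        coeff (1# · eλ parts) m + 0#      ≈⟨ +-identityʳ _ ⟩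
        coeff (1# · eλ parts) m           ≈⟨ coeff-· 1# (eλ parts) m ⟩
        1# * coeff (eλ parts) m           ≈⟨ *-identityˡ _ ⟩
        coeff (eλ parts) m                ∎
        where open GoodPartition λp

      ⟦⟧-++ : ∀ L L′ m → coeff ⟦ L ++ L′ ⟧ m ≈ coeff ⟦ L ⟧ m + coeff ⟦ L′ ⟧ m
      ⟦⟧-++ []             L′ m = sym (+-identityˡ _)
      ⟦⟧-++ ((a , λp) ∷ L) L′ m = begin
        coeff (g ⊕ ⟦ L ++ L′ ⟧) m                       ≈⟨ coeff-⊕ g ⟦ L ++ L′ ⟧ m ⟩
        coeff g m + coeff ⟦ L ++ L′ ⟧ m                 ≈⟨ +-congˡ (⟦⟧-++ L L′ m) ⟩
        coeff g m + (coeff ⟦ L ⟧ m + coeff ⟦ L′ ⟧ m)    ≈⟨ +-assoc _ _ _ ⟨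
        (coeff g m + coeff ⟦ L ⟧ m) + coeff ⟦ L′ ⟧ m    ≈⟨ +-congʳ (coeff-⊕ g ⟦ L ⟧ m) ⟨
        coeff (g ⊕ ⟦ L ⟧) m + coeff ⟦ L′ ⟧ m            ∎
        where g = a · eλ (GoodPartition.parts λp)

      _·ᶜ_ : Carrier → Combination → Combination
      a ·ᶜ L = List.map (λ (b , λp) → (a * b , λp)) L

      ⟦⟧-scale : ∀ a L m → coeff ⟦ a ·ᶜ L ⟧ m ≈ a * coeff ⟦ L ⟧ m
      ⟦⟧-scale a []             m = sym (zeroʳ a)
      ⟦⟧-scale a ((b , λp) ∷ L) m = begin
        coeff (((a * b) · g) ⊕ ⟦ a ·ᶜ L ⟧) m          ≈⟨ coeff-⊕ ((a * b) · g) ⟦ a ·ᶜ L ⟧ m ⟩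
        coeff ((a * b) · g) m + coeff ⟦ a ·ᶜ L ⟧ m    ≈⟨ +-cong (coeff-· (a * b) g m) (⟦⟧-scale a L m) ⟩
        (a * b) * coeff g m + a * coeff ⟦ L ⟧ m       ≈⟨ +-congʳ (trans (*-assoc a b _) (*-congˡ (sym (coeff-· b g m)))) ⟩
        a * coeff (b · g) m + a * coeff ⟦ L ⟧ m       ≈⟨ distribˡ a _ _ ⟨
        a * (coeff (b · g) m + coeff ⟦ L ⟧ m)         ≈⟨ *-congˡ (coeff-⊕ (b · g) ⟦ L ⟧ m) ⟨
        a * coeff ((b · g) ⊕ ⟦ L ⟧) m                 ∎
        where g = eλ (GoodPartition.parts λp)

      Spanned-+ : ∀ {φ ψ} → Spanned φ → Spanned ψ → Spanned (λ m → φ m + ψ m)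
      Spanned-+ (L , ⟦L⟧≈φ) (L′ , ⟦L′⟧≈ψ) = L ++ L′ , λ m → trans (⟦⟧-++ L L′ m) (+-cong (⟦L⟧≈φ m) (⟦L′⟧≈ψ m))

      Spanned-* : ∀ a {φ} → Spanned φ → Spanned (λ m → a * φ m)
      Spanned-* a (L , ⟦L⟧≈φ) = a ·ᶜ L , λ m → trans (⟦⟧-scale a L m) (*-congˡ (⟦L⟧≈φ m))

      Spanned-- : ∀ {φ ψ} → Spanned φ → Spanned ψ → Spanned (λ m → φ m - ψ m)
      Spanned-- φ ψ = Spanned-resp (λ m → +-congˡ (-1*x≈-x _)) (Spanned-+ φ (Spanned-* (- 1#) ψ))

      prepend : ∀ i → 1 ≤ i → i ≤ n → Combination → Combination
      prepend i 1≤i i≤n = List.map λ where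
        (a , goodPartition ks ks-in-range coprime-part) →
          (a , goodPartition (i ∷ ks) ((1≤i , i≤n) ∷ᴬ ks-in-range) (there coprime-part))

      ⟦⟧-prepend : ∀ i 1≤i i≤n L → ⟦ prepend i 1≤i i≤n L ⟧ ≋ (e i ⊗ ⟦ L ⟧)
      ⟦⟧-prepend i 1≤i i≤n []                                  = λ m → sym (⊗-zeroʳ (e i) m)
      ⟦⟧-prepend i 1≤i i≤n ((a , goodPartition ks _ _) ∷ L) m = begin
        coeff ((a · (e i ⊗ eλ ks)) ⊕ ⟦ iL ⟧) m                      ≈⟨ coeff-⊕ (a · (e i ⊗ eλ ks)) ⟦ iL ⟧ m ⟩
        coeff (a · (e i ⊗ eλ ks)) m + coeff ⟦ iL ⟧ m                ≈⟨ +-cong (sym (⊗-·-comm (e i) a (eλ ks) m)) (⟦⟧-prepend i 1≤i i≤n L m) ⟩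
        coeff (e i ⊗ (a · eλ ks)) m + coeff (e i ⊗ ⟦ L ⟧) m         ≈⟨ coeff-⊕ (e i ⊗ (a · eλ ks)) (e i ⊗ ⟦ L ⟧) m ⟨
        coeff ((e i ⊗ (a · eλ ks)) ⊕ (e i ⊗ ⟦ L ⟧)) m               ≈⟨ ⊗-distribˡ-⊕ (e i) (a · eλ ks) ⟦ L ⟧ m ⟨
        coeff (e i ⊗ ((a · eλ ks) ⊕ ⟦ L ⟧)) m                       ∎
        where iL = prepend i 1≤i i≤n L

      Spanned-e⊗ : ∀ i → 1 ≤ i → ∀ {f} → Spanned (coeff f) → Spanned (coeff (e i ⊗ f))
      Spanned-e⊗ i 1≤i {f} (L , ⟦L⟧≋f) with i ℕ.≤? n
      ... | yes i≤n = prepend i 1≤i i≤n L , λ m → trans (⟦⟧-prepend i 1≤i i≤n L m) (⊗-congˡ (e i) ⟦L⟧≋f m)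
      ... | no  i≰n rewrite e-vanishes i (NP.≰⇒> i≰n) = Spanned-zero

      module _ (isField : IsField K) (char : HasCharacteristic K r) where

        natCast*e-spanned : ∀ k → 1 ≤ k → Spanned (λ m → natCast K k * coeff (e k) m)
        natCast*e-spanned k 1≤k with coprime? k r
        ... | no ¬coprime = Spanned-resp (λ m → sym (trans (*-congʳ (natCast-not-coprime isField char k ¬coprime)) (zeroˡ _)))
                                         Spanned-zero
        ... | yes coprime with k ℕ.≤? n
        ...   | yes k≤n = Spanned-* (natCast K k) (Spanned-resp (⊗-identityʳ (e k))
                            (Spanned-generator (goodPartition (k ∷ []) ((1≤k , k≤n) ∷ᴬ []ᴬ) (here coprime))))
        ...   | no  k≰n = Spanned-resp (λ m → sym (trans (*-congˡ (reflexive (P.cong (λ f → coeff f m) (e-vanishes k (NP.≰⇒> k≰n)))))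
                                                        (zeroʳ _)))
                                       Spanned-zero

        mixed-spanned : ∀ i j → (∀ k → 1 ≤ k → k ≤ j → Spanned (coeff (p k))) → Spanned (mixed (suc i) j id)
        mixed-spanned i zero    _           =
          Spanned-resp (λ m → sym (mixed-0≈e (suc i) m)) (natCast*e-spanned (suc i) (s≤s z≤n))
        mixed-spanned i (suc j) p-spanned-≤ =
          Spanned-resp (λ m → x≈y+z⇒x-z≈y (newton-step (suc i) j m))
            (Spanned-- (Spanned-e⊗ (suc i) (s≤s z≤n) (p-spanned-≤ (suc j) (s≤s z≤n) NP.≤-refl))
                       (mixed-spanned (suc i) j λ k 1≤k k≤j → p-spanned-≤ k 1≤k (NP.m≤n⇒m≤1+n k≤j)))

        p-spanned : ∀ k → 1 ≤ k → Spanned (coeff (p k))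
        p-spanned = <-rec _ λ where
          zero    _             ()
          (suc k) p-spanned-< _ → Spanned-resp (mixed-1≈p k)
            (mixed-spanned 0 k λ j 1≤j j≤k → p-spanned-< (s≤s j≤k) 1≤j)

        p-InE : ∀ k → 1 ≤ k → InE r (p k)
        p-InE k 1≤k = Spanned⇒InE (p-spanned k 1≤k)

proposition3p1 : ∀ {c ℓ : Level} (K : CommutativeRing c ℓ) → IsField K → (r : ℕ) → HasCharacteristic K r → (n : ℕ) → r ≤ n → (f : Poly.Pol K n) → Poly.InPowerSums K n f → Poly.InE K n r f
proposition3p1 K isField r char n _ f = InSubalg-least K n (λ (k , 1≤k) → p-InE K n r isField char k 1≤k)
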